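{- Let $K=[n]$ and $\tau=\epsilon_n=12\cdots n$. (1) If $n\ge3$ and $\phi=(n,1,2,\dots,n-1)$ or $\phi=(2,\dots,n,1)$, then $$(t-1)^{n-3}t=\sum_{\gamma\in\Phi_\tau(\phi)}(-1)^{n-\ell(\gamma)}\prod_{i:\ 1,n\notin\gamma(r_i)}(\gamma_it+1).$$ (2) If $n\ge4$ and $\phi=(n,2,\dots,n-1,1)$, then $$(t-1)^{n-4}t^2=\sum_{\gamma\in\Phi_\tau(\phi)}(-1)^{n-\ell(\gamma)}\prod_{i:\ 1,n\notin\gamma(r_i)}(\gamma_it+1).$$
   Context: $L[K]$ is the set of linear orders on $K$, identified with words. For $\tau\in L[K]$, $1_\tau,m_\tau$ are the $\tau$-smallest and $\tau$-largest elements (here $1$ and $n$). A skew ribbon shape $\Gamma$ of size $n$ is a sequence of $n$ cells $c_1,\dots,c_n$ in the plane (up to translation) such that each $c_{j+1}$ is immediately east, immediately south, or immediately (diagonally) southeast of $c_j$. Rows $r_1,r_2,\dots$ are numbered from top to bottom; $\ell(\gamma)$ is the number of rows, $\gamma_i$ the number of cells in row $i$. A standard filling (w.r.t. $\tau$) is a bijection $\gamma:\Gamma\to K$ increasing w.r.t. $\tau$ along rows from left to right and along columns from bottom to top; $\gamma(r_i)$ is the set of values in row $i$. $\phi\in L[K]$ fits $\Gamma$ w.r.t. $\tau$ if the filling $\gamma_\phi$ putting the $j$-th letter of $\phi$ in cell $c_j$ is standard w.r.t. $\tau$, and whenever $c_{j+1}$ is strictly southeast of $c_j$ the $j$-th letter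 of $\phi$ is $\tau$-smaller than the $(j+1)$-st. $\Phi_\tau(\phi)$ is the set of fillings $\gamma_\phi$, over all skew ribbon shapes $\Gamma$ that $\phi$ fits w.r.t. $\tau$, such that every row contains at most one of $1_\tau,m_\tau$. -}

module Defs where

open import Data.Nat as ℕ using (ℕ; zero; suc; _<_; _∸_; _≟_)
open import Data.Integer as ℤ using (ℤ; +_; -[1+_])
open import Data.Bool using (Bool; true; false; if_then_else_; _∨_)
open import Data.List using (List; []; _∷_; map; filter; length; upTo; _++_; [_])
open import Data.List.Membership.Propositional using (_∈_)
open import Data.List.Relation.Unary.Unique.Propositional using (Unique)
open import Data.Product using (_×_; _,_; proj₁; proj₂)
open import Data.Unit using (⊤)
open import Data.Empty using (⊥)
open import Relation.Nullary using (¬_)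
open import Relation.Nullary.Decidable using (⌊_⌋)
open import Relation.Binary.PropositionalEquality using (_≡_)
import Data.List.Membership.DecPropositional as DecMem
open import Function.Bundles using (_⇔_)

-- K = [n] = {1,…,n}, τ = ε_n = 12…n, so "τ-smaller" is the usual < on ℕ,
-- 1_τ = 1 and m_τ = n.  Words (linear orders) are lists of naturals.

-- A skew ribbon shape (up to translation) is the list of its n-1 steps
-- c_j ↦ c_{j+1}: east, south, or south-east.
data Step : Set where
  E S SE : Step

-- A cell as (row, column); rows numbered from top (row 0) to bottom,
-- columns from left to right.  The first cell is placed at (0,0).
Cell : Set
Cell = ℕ × ℕ

move : Step → Cell → Cell
move E  (r , c) = (r , suc c)
move S  (r , c) = (suc r , c)
move SE (r , c) = (suc r , suc c)

cells : List Step → List Cell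
cells [] = (0 , 0) ∷ []
cells (s ∷ ss) = (0 , 0) ∷ map (move s) (cells ss)

downs : List Step → ℕ
downs [] = 0
downs (E ∷ ss) = downs ss
downs (S ∷ ss) = suc (downs ss)
downs (SE ∷ ss) = suc (downs ss)

numRows : List Step → ℕ
numRows ss = suc (downs ss)

zipL : {A B : Set} → List A → List B → List (A × B)
zipL (a ∷ as) (b ∷ bs) = (a , b) ∷ zipL as bs
zipL _ _ = []

filling : List Step → List ℕ → List (Cell × ℕ)
filling Γ φ = zipL (cells Γ) φ

row col : Cell × ℕ → ℕ
row ((r , c) , v) = r
col ((r , c) , v) = c

val : Cell × ℕ → ℕ
val (_ , v) = v

Standard : List (Cell × ℕ) → Set
Standard F = ∀ a b → a ∈ F → b ∈ F →
  ((row a ≡ row b) → col a < col b → val a < val b) ×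
  ((col a ≡ col b) → row b < row a → val a < val b)

SECond : List Step → List ℕ → Set
SECond (SE ∷ ss) (a ∷ b ∷ xs) = (a < b) × SECond ss (b ∷ xs)
SECond (_  ∷ ss) (a ∷ b ∷ xs) = SECond ss (b ∷ xs)
SECond _ _ = ⊤

Fits : List ℕ → List Step → Set
Fits φ Γ = (suc (length Γ) ≡ length φ) × Standard (filling Γ φ) × SECond Γ φ

rowVals : List Step → List ℕ → ℕ → List ℕ
rowVals Γ φ i = map val (filter (λ e → row e ≟ i) (filling Γ φ))

-- Γ indexes an element γ_φ of Φ_τ(φ) (K = [n]): φ fits Γ and every row
-- contains at most one of 1 and n.
InΦ : ℕ → List ℕ → List Step → Set
InΦ n φ Γ = Fits φ Γ × (∀ i → i < numRows Γ → ¬ ((1 ∈ rowVals Γ φ i) × (n ∈ rowVals Γ φ i)))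

EnumΦ : ℕ → List ℕ → List (List Step) → Set
EnumΦ n φ L = Unique L × (∀ Γ → (Γ ∈ L) ⇔ InΦ n φ Γ)

open DecMem _≟_ using (_∈?_)

rowFactor : ℕ → List Step → List ℕ → ℤ → ℕ → ℤ
rowFactor n Γ φ t i =
  if ⌊ 1 ∈? rowVals Γ φ i ⌋ ∨ ⌊ n ∈? rowVals Γ φ i ⌋
  then ℤ.+ 1
  else (ℤ.+ length (rowVals Γ φ i)) ℤ.* t ℤ.+ ℤ.+ 1

prodRows : (ℕ → ℤ) → ℕ → ℤ
prodRows f zero = ℤ.+ 1
prodRows f (suc k) = prodRows f k ℤ.* f k

weight : ℕ → List ℕ → ℤ → List Step → ℤ
weight n φ t Γ = (ℤ.- ℤ.+ 1) ℤ.^ (n ∸ numRows Γ) ℤ.* prodRows (rowFactor n Γ φ t) (numRows Γ)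

sumℤ : List ℤ → ℤ
sumℤ [] = ℤ.+ 0
sumℤ (x ∷ xs) = x ℤ.+ sumℤ xs

ΦSum : ℕ → List ℕ → ℤ → List (List Step) → ℤ
ΦSum n φ t L = sumℤ (map (weight n φ t) L)

φA : ℕ → List ℕ
φA n = n ∷ map suc (upTo (n ∸ 1))

φB : ℕ → List ℕ
φB n = map (λ k → suc (suc k)) (upTo (n ∸ 1)) ++ [ 1 ]

φC : ℕ → List ℕ
φC n = n ∷ (map (λ k → suc (suc k)) (upTo (n ∸ 2)) ++ [ 1 ])

-- A ribbon filling is standard exactly when every pair of consecutive letters
-- satisfies the condition of the step between them: an ascent before an east or
-- south-east step, a descent before a south step.  For each of the three words
-- the steps around n and 1 are therefore forced to be south steps and the
-- remaining letters increase, so Φ_τ(φ) is in bijection with the words w in E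
-- and SE of a fixed length.  The sign (-1)^(n-ℓ) is (-1)^(number of E in w), and
-- the weight is the product of γ_i t + 1 over the rows, the rows holding 1 or n
-- contributing 1 instead.  Splitting on the first step of w gives the
-- recursion S(k+1, a) = -S(k, a+1) + ((a+1)t + 1) S(k, 0) in the number a of
-- cells already in the current row, solved by (t-1)^k C (a+1).

module Submission where

open import Defs
open import Data.Nat as ℕ using (ℕ; zero; suc; _<_; _≤_; _∸_; _≟_; z≤n; s≤s)
import Data.Nat.Properties as ℕP
open import Data.Integer using (ℤ; +_; _+_; _*_; -_; _-_; _^_)
import Data.Integer.Properties as ℤP
open import Data.Integer.Tactic.RingSolver using (solve-∀)
open import Data.List using (List; []; _∷_; map; _++_; length; [_]; filter; applyUpTo)
open import Data.List.Relation.Unary.Linked as Linked using (Linked)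
open import Data.List.Properties
  using (map-++; map-∘; map-cong; map-cong-local; ∷-injectiveʳ; ∷ʳ-injectiveˡ; length-++; ++-assoc;
         applyUpTo-∷ʳ; length-applyUpTo; map-upTo)
open import Data.List.Membership.Propositional using (_∈_)
open import Data.List.Membership.DecPropositional _≟_ using (_∈?_)
open import Data.List.Relation.Binary.Subset.Propositional using (_⊆_)
open import Data.List.Relation.Binary.Subset.Propositional.Properties using (⊆-trans; xs⊆x∷xs)
open import Function.Base using (_∘_)
open import Data.List.Membership.Propositional.Properties using (∈-map⁻; ∈-map⁺; ∈-++⁻; ∈-++⁺ˡ; ∈-++⁺ʳ)
open import Data.List.Membership.Propositional.Properties.WithK using (unique∧set⇒bag)
open import Data.List.Relation.Binary.BagAndSetEquality using (∼bag⇒↭)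
open import Data.List.Relation.Binary.Permutation.Propositional as Perm using (_↭_)
import Data.List.Relation.Binary.Permutation.Propositional.Properties as ↭
open import Data.List.Relation.Unary.Any using (here; there)
open import Data.List.Relation.Unary.All as All using (All; []; _∷_)
open import Data.List.Relation.Unary.Unique.Propositional using (Unique)
import Data.List.Relation.Unary.AllPairs as AllPairs
import Data.List.Relation.Unary.Unique.Propositional.Properties as Unique
open import Data.Product using (_×_; _,_; proj₁; proj₂; ∃; map₁; uncurry)
open import Data.Sum using (_⊎_; inj₁; inj₂)
open import Data.Unit using (⊤; tt)
open import Data.Empty using (⊥; ⊥-elim)
open import Relation.Nullary using (¬_; does)
open import Data.Bool using (true; false; if_then_else_; _∨_)
open import Relation.Nullary.Decidable using (⌊_⌋; isYes≗does; dec-true; dec-false)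
open import Data.Bool.Properties using (∨-zeroʳ)
open import Data.List.Relation.Unary.All.Properties using (All¬⇒¬Any; ++⁺; applyUpTo⁺₁)
open import Function.Bundles using (_⇔_; mk⇔; Equivalence)
open import Relation.Binary.PropositionalEquality
  using (_≡_; refl; sym; trans; cong; cong₂; subst; module ≡-Reasoning)

sumℤ-++ : ∀ xs ys → sumℤ (xs ++ ys) ≡ sumℤ xs + sumℤ ys
sumℤ-++ [] ys = sym (ℤP.+-identityˡ _)
sumℤ-++ (x ∷ xs) ys = trans (cong (_+_ x) (sumℤ-++ xs ys)) (sym (ℤP.+-assoc x _ _))

sumℤ-map-*ˡ : ∀ {A : Set} c (f : A → ℤ) xs → sumℤ (map (λ x → c * f x) xs) ≡ c * sumℤ (map f xs)
sumℤ-map-*ˡ c f [] = sym (ℤP.*-zeroʳ c)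
sumℤ-map-*ˡ c f (x ∷ xs) =
  trans (cong (_+_ (c * f x)) (sumℤ-map-*ˡ c f xs)) (sym (ℤP.*-distribˡ-+ c (f x) _))

sumℤ-map-neg : ∀ {A : Set} (f : A → ℤ) xs → sumℤ (map (λ x → - f x) xs) ≡ - sumℤ (map f xs)
sumℤ-map-neg f [] = refl
sumℤ-map-neg f (x ∷ xs) =
  trans (cong (_+_ (- f x)) (sumℤ-map-neg f xs)) (sym (ℤP.neg-distrib-+ (f x) _))

sumℤ-↭ : ∀ {xs ys} → xs ↭ ys → sumℤ xs ≡ sumℤ ys
sumℤ-↭ Perm.refl = refl
sumℤ-↭ (Perm.prep x p) = cong (_+_ x) (sumℤ-↭ p)
sumℤ-↭ (Perm.swap x y p) = begin
  x + (y + _) ≡⟨ sym (ℤP.+-assoc x y _) ⟩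
  (x + y) + _ ≡⟨ cong₂ _+_ (ℤP.+-comm x y) (sumℤ-↭ p) ⟩
  (y + x) + _ ≡⟨ ℤP.+-assoc y x _ ⟩
  y + (x + _) ∎
  where open ≡-Reasoning
sumℤ-↭ (Perm.trans p q) = trans (sumℤ-↭ p) (sumℤ-↭ q)

sumℤ-enumerations : ∀ {A : Set} {P : A → Set} (f : A → ℤ) {L M : List A} →
  Unique L → Unique M → (∀ x → (x ∈ L) ⇔ P x) → (∀ x → (x ∈ M) ⇔ P x) →
  sumℤ (map f L) ≡ sumℤ (map f M)
sumℤ-enumerations f uL uM L⇔P M⇔P = sumℤ-↭ (↭.map⁺ f (∼bag⇒↭ (unique∧set⇒bag uL uM L∼M)))
  where
  open Equivalence
  L∼M = λ {x} → mk⇔ (λ x∈L → from (M⇔P x) (to (L⇔P x) x∈L)) (λ x∈M → from (L⇔P x) (to (M⇔P x) x∈M))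

NoSouth : List Step → Set
NoSouth [] = ⊤
NoSouth (E ∷ w) = NoSouth w
NoSouth (S ∷ w) = ⊥
NoSouth (SE ∷ w) = NoSouth w

noSouthWords : ℕ → List (List Step)
noSouthWords zero = [ [] ]
noSouthWords (suc k) = map (E ∷_) (noSouthWords k) ++ map (SE ∷_) (noSouthWords k)

∈-noSouthWords⁻ : ∀ k {w} → w ∈ noSouthWords k → length w ≡ k × NoSouth w
∈-noSouthWords⁻ zero (here refl) = refl , tt
∈-noSouthWords⁻ (suc k) w∈ with ∈-++⁻ (map (E ∷_) (noSouthWords k)) w∈
... | inj₁ w∈E with ∈-map⁻ (E ∷_) w∈E
...   | w′ , w′∈ , refl = map₁ (cong suc) (∈-noSouthWords⁻ k w′∈)
∈-noSouthWords⁻ (suc k) w∈ | inj₂ w∈SE with ∈-map⁻ (SE ∷_) w∈SE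
...   | w′ , w′∈ , refl = map₁ (cong suc) (∈-noSouthWords⁻ k w′∈)

∈-noSouthWords⁺ : ∀ {k} w → length w ≡ k → NoSouth w → w ∈ noSouthWords k
∈-noSouthWords⁺ [] refl _ = here refl
∈-noSouthWords⁺ {suc k} (E ∷ w) refl ns = ∈-++⁺ˡ (∈-map⁺ (E ∷_) (∈-noSouthWords⁺ w refl ns))
∈-noSouthWords⁺ {suc k} (SE ∷ w) refl ns =
  ∈-++⁺ʳ (map (E ∷_) (noSouthWords k)) (∈-map⁺ (SE ∷_) (∈-noSouthWords⁺ w refl ns))

noSouthWords-unique : ∀ k → Unique (noSouthWords k)
noSouthWords-unique zero = [] AllPairs.∷ AllPairs.[]
noSouthWords-unique (suc k) =
  Unique.++⁺ (Unique.map⁺ ∷-injectiveʳ (noSouthWords-unique k))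
             (Unique.map⁺ ∷-injectiveʳ (noSouthWords-unique k))
             E∉SE
  where
  E∉SE : ∀ {v} → ¬ (v ∈ map (E ∷_) (noSouthWords k) × v ∈ map (SE ∷_) (noSouthWords k))
  E∉SE (v∈E , v∈SE) with ∈-map⁻ (E ∷_) v∈E | ∈-map⁻ (SE ∷_) v∈SE
  ... | _ , _ , refl | _ , _ , ()

eastSteps : List Step → ℕ
eastSteps [] = 0
eastSteps (E ∷ w) = suc (eastSteps w)
eastSteps (S ∷ w) = eastSteps w
eastSteps (SE ∷ w) = eastSteps w

sign : ℕ → ℤ
sign k = (- + 1) ^ k

eastSteps-∷ʳ-S : ∀ w → eastSteps (w ++ [ S ]) ≡ eastSteps w
eastSteps-∷ʳ-S [] = refl
eastSteps-∷ʳ-S (E ∷ w) = cong suc (eastSteps-∷ʳ-S w)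
eastSteps-∷ʳ-S (S ∷ w) = eastSteps-∷ʳ-S w
eastSteps-∷ʳ-S (SE ∷ w) = eastSteps-∷ʳ-S w

signedSum : (List Step → ℤ) → ℕ → ℤ
signedSum P k = sumℤ (map (λ w → sign (eastSteps w) * P w) (noSouthWords k))

signedSum-cong : ∀ {P Q} k → (∀ w → P w ≡ Q w) → signedSum P k ≡ signedSum Q k
signedSum-cong k P≗Q = cong sumℤ (map-cong (λ w → cong (sign (eastSteps w) *_) (P≗Q w)) (noSouthWords k))

signedSum-*ˡ : ∀ c Q k → signedSum (λ w → c * Q w) k ≡ c * signedSum Q k
signedSum-*ˡ c Q k = begin
  signedSum (λ w → c * Q w) k
    ≡⟨ cong sumℤ (map-cong (λ w → swap-*ˡ (sign (eastSteps w)) c (Q w)) (noSouthWords k)) ⟩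
  sumℤ (map (λ w → c * (sign (eastSteps w) * Q w)) (noSouthWords k))
    ≡⟨ sumℤ-map-*ˡ c _ (noSouthWords k) ⟩
  c * signedSum Q k ∎
  where
  open ≡-Reasoning
  swap-*ˡ : ∀ x y z → x * (y * z) ≡ y * (x * z)
  swap-*ˡ = solve-∀

signedSum-suc : ∀ P k → signedSum P (suc k) ≡ - signedSum (λ w → P (E ∷ w)) k + signedSum (λ w → P (SE ∷ w)) k
signedSum-suc P k = begin
  signedSum P (suc k)
    ≡⟨ cong sumℤ (map-++ f (map (E ∷_) W) (map (SE ∷_) W)) ⟩
  sumℤ (map f (map (E ∷_) W) ++ map f (map (SE ∷_) W))
    ≡⟨ sumℤ-++ (map f (map (E ∷_) W)) _ ⟩
  sumℤ (map f (map (E ∷_) W)) + sumℤ (map f (map (SE ∷_) W))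
    ≡⟨ cong₂ _+_ (cong sumℤ (sym (map-∘ W))) (cong sumℤ (sym (map-∘ W))) ⟩
  sumℤ (map (λ w → sign (suc (eastSteps w)) * P (E ∷ w)) W) + signedSum PSE k
    ≡⟨ cong (_+ signedSum PSE k) (cong sumℤ (map-cong (λ w → sign-suc (sign (eastSteps w)) (P (E ∷ w))) W)) ⟩
  sumℤ (map (λ w → - (sign (eastSteps w) * P (E ∷ w))) W) + signedSum PSE k
    ≡⟨ cong (_+ signedSum PSE k) (sumℤ-map-neg (λ w → sign (eastSteps w) * P (E ∷ w)) W) ⟩
  - signedSum (λ w → P (E ∷ w)) k + signedSum PSE k ∎
  where
  open ≡-Reasoning
  W = noSouthWords k
  f = λ w → sign (eastSteps w) * P w
  PSE = λ w → P (SE ∷ w)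
  sign-suc : ∀ s x → (- + 1 * s) * x ≡ - (s * x)
  sign-suc = solve-∀

rowWeight : ℤ → ℕ → ℤ
rowWeight t a = + a * t + + 1

-- Products of rowWeight over the row lengths of a ribbon word (S and SE both
-- start a new row); rowProdInit omits the last row and rowProdTail the first.
-- The parameter a counts the cells already in the current row.
rowProd : ℤ → ℕ → List Step → ℤ
rowProd t a [] = rowWeight t (suc a)
rowProd t a (E ∷ w) = rowProd t (suc a) w
rowProd t a (S ∷ w) = rowWeight t (suc a) * rowProd t 0 w
rowProd t a (SE ∷ w) = rowWeight t (suc a) * rowProd t 0 w

rowProdInit : ℤ → ℕ → List Step → ℤ
rowProdInit t a [] = + 1
rowProdInit t a (E ∷ w) = rowProdInit t (suc a) w
rowProdInit t a (S ∷ w) = rowWeight t (suc a) * rowProdInit t 0 w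
rowProdInit t a (SE ∷ w) = rowWeight t (suc a) * rowProdInit t 0 w

rowProdTail : ℤ → List Step → ℤ
rowProdTail t [] = + 1
rowProdTail t (E ∷ w) = rowProdTail t w
rowProdTail t (S ∷ w) = rowProd t 0 w
rowProdTail t (SE ∷ w) = rowProd t 0 w

module RowRecursion (t : ℤ) (P : ℕ → List Step → ℤ)
  (P-E : ∀ a w → P a (E ∷ w) ≡ P (suc a) w)
  (P-SE : ∀ a w → P a (SE ∷ w) ≡ rowWeight t (suc a) * P 0 w) where

  signedSum-row : ∀ k a → signedSum (P a) (suc k) ≡ - signedSum (P (suc a)) k + rowWeight t (suc a) * signedSum (P 0) k
  signedSum-row k a = trans (signedSum-suc (P a) k)
    (cong₂ (λ x y → - x + y) (signedSum-cong k (P-E a))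
                             (trans (signedSum-cong k (P-SE a)) (signedSum-*ˡ (rowWeight t (suc a)) (P 0) k)))

  -- Since ((a+1)t + 1) - (a+2) = (a+1)(t - 1), a solution linear in a + 1 is
  -- reproduced by the recursion up to a factor t - 1.
  signedSum-closedForm : ∀ C → (∀ a → signedSum (P a) 1 ≡ C * + suc a) →
    ∀ k a → signedSum (P a) (suc k) ≡ (t - + 1) ^ k * C * + suc a
  signedSum-closedForm C base zero a = trans (base a) (sym (cong (_* + suc a) (ℤP.*-identityˡ C)))
  signedSum-closedForm C base (suc k) a = begin
    signedSum (P a) (suc (suc k))
      ≡⟨ signedSum-row (suc k) a ⟩
    - signedSum (P (suc a)) (suc k) + rowWeight t (suc a) * signedSum (P 0) (suc k)
      ≡⟨ cong₂ (λ x y → - x + rowWeight t (suc a) * y)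
               (signedSum-closedForm C base k (suc a)) (signedSum-closedForm C base k 0) ⟩
    - ((t - + 1) ^ k * C * + suc (suc a)) + rowWeight t (suc a) * ((t - + 1) ^ k * C * + 1)
      ≡⟨ cong (λ x → - ((t - + 1) ^ k * C * x) + rowWeight t (suc a) * ((t - + 1) ^ k * C * + 1)) (ℤP.pos-+ 1 (suc a)) ⟩
    - ((t - + 1) ^ k * C * (+ 1 + + suc a)) + rowWeight t (suc a) * ((t - + 1) ^ k * C * + 1)
      ≡⟨ step ((t - + 1) ^ k) C t (+ suc a) ⟩
    (t - + 1) ^ suc k * C * + suc a ∎
    where
    open ≡-Reasoning
    step : ∀ X C t A → - (X * C * (+ 1 + A)) + (A * t + + 1) * (X * C * + 1) ≡ (t - + 1) * X * C * A
    step = solve-∀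

signedSum-one : ∀ P → signedSum P 1 ≡ - P (E ∷ []) + P (SE ∷ [])
signedSum-one P = expand (P (E ∷ [])) (P (SE ∷ []))
  where
  expand : ∀ x y → (- + 1 * + 1) * x + (+ 1 * y + + 0) ≡ - x + y
  expand = solve-∀

signedSum-rowProd : ∀ t k a → signedSum (rowProd t a) (suc k) ≡ (t - + 1) ^ k * (t * t) * + suc a
signedSum-rowProd t = signedSum-closedForm (t * t) base
  where
  open RowRecursion t (rowProd t) (λ _ _ → refl) (λ _ _ → refl)
  base : ∀ a → signedSum (rowProd t a) 1 ≡ t * t * + suc a
  base a = begin
    signedSum (rowProd t a) 1
      ≡⟨ signedSum-one (rowProd t a) ⟩
    - (+ suc (suc a) * t + + 1) + (+ suc a * t + + 1) * (+ 1 * t + + 1)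
      ≡⟨ cong (λ x → - (x * t + + 1) + rowWeight t (suc a) * rowWeight t 1) (ℤP.pos-+ 1 (suc a)) ⟩
    - ((+ 1 + + suc a) * t + + 1) + (+ suc a * t + + 1) * (+ 1 * t + + 1)
      ≡⟨ expand t (+ suc a) ⟩
    t * t * + suc a ∎
    where
    open ≡-Reasoning
    expand : ∀ t A → - ((+ 1 + A) * t + + 1) + (A * t + + 1) * (+ 1 * t + + 1) ≡ t * t * A
    expand = solve-∀

signedSum-rowProdInit : ∀ t k a → signedSum (rowProdInit t a) (suc k) ≡ (t - + 1) ^ k * t * + suc a
signedSum-rowProdInit t = signedSum-closedForm t base
  where
  open RowRecursion t (rowProdInit t) (λ _ _ → refl) (λ _ _ → refl)
  base : ∀ a → signedSum (rowProdInit t a) 1 ≡ t * + suc a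
  base a = trans (signedSum-one (rowProdInit t a)) (expand t (+ suc a))
    where
    expand : ∀ t A → - + 1 + (A * t + + 1) * + 1 ≡ t * A
    expand = solve-∀

signedSum-rowProdTail : ∀ t k → signedSum (rowProdTail t) (suc k) ≡ (t - + 1) ^ k * t
signedSum-rowProdTail t zero = trans (signedSum-one (rowProdTail t)) (expand t)
  where
  expand : ∀ t → - + 1 + (+ 1 * t + + 1) ≡ + 1 * t
  expand = solve-∀
signedSum-rowProdTail t (suc k) = begin
  signedSum (rowProdTail t) (suc (suc k))
    ≡⟨ signedSum-suc (rowProdTail t) (suc k) ⟩
  - signedSum (rowProdTail t) (suc k) + signedSum (rowProd t 0) (suc k)
    ≡⟨ cong₂ (λ x y → - x + y) (signedSum-rowProdTail t k) (signedSum-rowProd t k 0) ⟩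
  - ((t - + 1) ^ k * t) + (t - + 1) ^ k * (t * t) * + 1
    ≡⟨ step ((t - + 1) ^ k) t ⟩
  (t - + 1) ^ suc k * t ∎
  where
  open ≡-Reasoning
  step : ∀ X t → - (X * t) + X * (t * t) * + 1 ≡ (t - + 1) * X * t
  step = solve-∀

firstRow : List Step → List ℕ → List ℕ
firstRow [] xs = xs
firstRow (s ∷ w) [] = []
firstRow (E ∷ w) (x ∷ xs) = x ∷ firstRow w xs
firstRow (S ∷ w) (x ∷ xs) = [ x ]
firstRow (SE ∷ w) (x ∷ xs) = [ x ]

laterRows : List Step → List ℕ → List (List ℕ)
laterRows [] xs = []
laterRows (s ∷ w) [] = []
laterRows (E ∷ w) (x ∷ xs) = laterRows w xs
laterRows (S ∷ w) (x ∷ xs) = firstRow w xs ∷ laterRows w xs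
laterRows (SE ∷ w) (x ∷ xs) = firstRow w xs ∷ laterRows w xs

rows : List Step → List ℕ → List (List ℕ)
rows w xs = firstRow w xs ∷ laterRows w xs

rowAt : List (List ℕ) → ℕ → List ℕ
rowAt [] i = []
rowAt (r ∷ rs) zero = r
rowAt (r ∷ rs) (suc i) = rowAt rs i

shift : Step → Cell × ℕ → Cell × ℕ
shift s (c , v) = move s c , v

filling-∷ : ∀ s w x xs → filling (s ∷ w) (x ∷ xs) ≡ ((0 , 0) , x) ∷ map (shift s) (filling w xs)
filling-∷ s w x xs = cong (((0 , 0) , x) ∷_) (zipL-map (cells w) xs)
  where
  zipL-map : ∀ cs xs → zipL (map (move s) cs) xs ≡ map (shift s) (zipL cs xs)
  zipL-map [] xs = refl
  zipL-map (c ∷ cs) [] = refl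
  zipL-map (c ∷ cs) (x ∷ xs) = cong (_ ∷_) (zipL-map cs xs)

valuesInRow : ℕ → List (Cell × ℕ) → List ℕ
valuesInRow i F = map val (filter (λ e → row e ≟ i) F)

valuesInRow-shift : ∀ s i j F → (∀ e → does (row (shift s e) ≟ i) ≡ does (row e ≟ j)) →
  valuesInRow i (map (shift s) F) ≡ valuesInRow j F
valuesInRow-shift s i j [] same = refl
valuesInRow-shift s i j (e ∷ F) same rewrite same e with does (row e ≟ j)
... | true = cong (val e ∷_) (valuesInRow-shift s i j F same)
... | false = valuesInRow-shift s i j F same

valuesInRow-shiftDown : ∀ s F → (∀ e → row (shift s e) ≡ suc (row e)) → valuesInRow 0 (map (shift s) F) ≡ []
valuesInRow-shiftDown s [] down = refl
valuesInRow-shiftDown s (e ∷ F) down rewrite down e = valuesInRow-shiftDown s F down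

rowVals≡rowAt : ∀ w xs → length xs ≡ suc (length w) → ∀ i → rowVals w xs i ≡ rowAt (rows w xs) i
rowVals≡rowAt [] (x ∷ []) _ zero = refl
rowVals≡rowAt [] (x ∷ []) _ (suc i) = refl
rowVals≡rowAt (s ∷ w) (x ∷ xs) len i =
  trans (cong (valuesInRow i) (filling-∷ s w x xs)) (byStep s i)
  where
  F = filling w xs
  IH = rowVals≡rowAt w xs (ℕP.suc-injective len)
  byStep : ∀ s i → valuesInRow i (((0 , 0) , x) ∷ map (shift s) F) ≡ rowAt (rows (s ∷ w) (x ∷ xs)) i
  byStep E zero = cong (x ∷_) (trans (valuesInRow-shift E 0 0 F (λ _ → refl)) (IH 0))
  byStep E (suc i) = trans (valuesInRow-shift E (suc i) (suc i) F (λ _ → refl)) (IH (suc i))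
  byStep S zero = cong (x ∷_) (valuesInRow-shiftDown S F (λ _ → refl))
  byStep S (suc i) = trans (valuesInRow-shift S (suc i) i F (λ _ → refl)) (IH i)
  byStep SE zero = cong (x ∷_) (valuesInRow-shiftDown SE F (λ _ → refl))
  byStep SE (suc i) = trans (valuesInRow-shift SE (suc i) i F (λ _ → refl)) (IH i)

downs≡length-laterRows : ∀ w xs → length xs ≡ suc (length w) → downs w ≡ length (laterRows w xs)
downs≡length-laterRows [] (x ∷ []) _ = refl
downs≡length-laterRows (E ∷ w) (x ∷ xs) len = downs≡length-laterRows w xs (ℕP.suc-injective len)
downs≡length-laterRows (S ∷ w) (x ∷ xs) len = cong suc (downs≡length-laterRows w xs (ℕP.suc-injective len))
downs≡length-laterRows (SE ∷ w) (x ∷ xs) len = cong suc (downs≡length-laterRows w xs (ℕP.suc-injective len))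

length≡eastSteps+downs : ∀ w → length w ≡ eastSteps w ℕ.+ downs w
length≡eastSteps+downs [] = refl
length≡eastSteps+downs (E ∷ w) = cong suc (length≡eastSteps+downs w)
length≡eastSteps+downs (S ∷ w) = trans (cong suc (length≡eastSteps+downs w)) (sym (ℕP.+-suc (eastSteps w) (downs w)))
length≡eastSteps+downs (SE ∷ w) = trans (cong suc (length≡eastSteps+downs w)) (sym (ℕP.+-suc (eastSteps w) (downs w)))

size∸numRows≡eastSteps : ∀ w → suc (length w) ∸ numRows w ≡ eastSteps w
size∸numRows≡eastSteps w =
  trans (cong (_∸ downs w) (length≡eastSteps+downs w)) (ℕP.m+n∸n≡m (eastSteps w) (downs w))

prodℤ : List ℤ → ℤ
prodℤ [] = + 1
prodℤ (x ∷ xs) = x * prodℤ xs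

prodRows-rowAt : ∀ (f : List ℕ → ℤ) rs → prodRows (λ i → f (rowAt rs i)) (length rs) ≡ prodℤ (map f rs)
prodRows-rowAt f [] = refl
prodRows-rowAt f (r ∷ rs) = trans (prodRows-suc _ (length rs)) (cong (f r *_) (prodRows-rowAt f rs))
  where
  prodRows-suc : ∀ (g : ℕ → ℤ) k → prodRows g (suc k) ≡ g 0 * prodRows (λ i → g (suc i)) k
  prodRows-suc g zero = trans (ℤP.*-identityˡ (g 0)) (sym (ℤP.*-identityʳ (g 0)))
  prodRows-suc g (suc k) = trans (cong (_* g (suc k)) (prodRows-suc g k)) (ℤP.*-assoc (g 0) _ _)

prodRows-cong : ∀ {f g : ℕ → ℤ} k → (∀ i → f i ≡ g i) → prodRows f k ≡ prodRows g k
prodRows-cong zero f≗g = refl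
prodRows-cong (suc k) f≗g = cong₂ _*_ (prodRows-cong k f≗g) (f≗g k)

rowFactorOf : ℕ → ℤ → List ℕ → ℤ
rowFactorOf n t r = if ⌊ 1 ∈? r ⌋ ∨ ⌊ n ∈? r ⌋ then + 1 else rowWeight t (length r)

weight≡rowFactors : ∀ n t w φ → n ≡ suc (length w) → length φ ≡ suc (length w) →
  weight n φ t w ≡ sign (eastSteps w) * prodℤ (map (rowFactorOf n t) (rows w φ))
weight≡rowFactors n t w φ refl len = cong₂ _*_ (cong sign (size∸numRows≡eastSteps w)) (begin
  prodRows (rowFactor n w φ t) (numRows w)
    ≡⟨ prodRows-cong (numRows w) (λ i → cong (rowFactorOf n t) (rowVals≡rowAt w φ len i)) ⟩
  prodRows (λ i → rowFactorOf n t (rowAt (rows w φ) i)) (numRows w)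
    ≡⟨ cong (prodRows (λ i → rowFactorOf n t (rowAt (rows w φ) i))) (cong suc (downs≡length-laterRows w φ len)) ⟩
  prodRows (λ i → rowFactorOf n t (rowAt (rows w φ) i)) (length (rows w φ))
    ≡⟨ prodRows-rowAt (rowFactorOf n t) (rows w φ) ⟩
  prodℤ (map (rowFactorOf n t) (rows w φ)) ∎)
  where open ≡-Reasoning

Neutral : ℕ → ℕ → Set
Neutral n v = ¬ 1 ≡ v × ¬ n ≡ v

rowFactorOf-∋1 : ∀ n t r → 1 ∈ r → rowFactorOf n t r ≡ + 1
rowFactorOf-∋1 n t r 1∈r rewrite isYes≗does (1 ∈? r) | dec-true (1 ∈? r) 1∈r = refl

rowFactorOf-∋n : ∀ n t r → n ∈ r → rowFactorOf n t r ≡ + 1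
rowFactorOf-∋n n t r n∈r rewrite isYes≗does (n ∈? r) | dec-true (n ∈? r) n∈r | ∨-zeroʳ ⌊ 1 ∈? r ⌋ = refl

rowFactorOf-neutral : ∀ n t r → All (Neutral n) r → rowFactorOf n t r ≡ rowWeight t (length r)
rowFactorOf-neutral n t r neutral
  rewrite isYes≗does (1 ∈? r) | dec-false (1 ∈? r) (All¬⇒¬Any (All.map proj₁ neutral))
        | isYes≗does (n ∈? r) | dec-false (n ∈? r) (All¬⇒¬Any (All.map proj₂ neutral)) = refl

-- Standardness of a ribbon filling is a condition on consecutive letters

Adjacent : Step → ℕ → ℕ → Set
Adjacent E x y = x < y
Adjacent S x y = y < x
Adjacent SE x y = x < y

Local : List Step → List ℕ → Set
Local (s ∷ w) (x ∷ y ∷ xs) = Adjacent s x y × Local w (y ∷ xs)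
Local _ _ = ⊤

StandardPair : Cell × ℕ → Cell × ℕ → Set
StandardPair a b =
  (row a ≡ row b → col a < col b → val a < val b) × (col a ≡ col b → row b < row a → val a < val b)

standardPair-shift⁺ : ∀ s a b → StandardPair a b → StandardPair (shift s a) (shift s b)
standardPair-shift⁺ E a b (inRow , inCol) = (λ r c → inRow r (ℕ.s<s⁻¹ c)) , (λ c r → inCol (ℕP.suc-injective c) r)
standardPair-shift⁺ S a b (inRow , inCol) = (λ r c → inRow (ℕP.suc-injective r) c) , (λ c r → inCol c (ℕ.s<s⁻¹ r))
standardPair-shift⁺ SE a b (inRow , inCol) =
  (λ r c → inRow (ℕP.suc-injective r) (ℕ.s<s⁻¹ c)) , (λ c r → inCol (ℕP.suc-injective c) (ℕ.s<s⁻¹ r))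

standardPair-shift⁻ : ∀ s a b → StandardPair (shift s a) (shift s b) → StandardPair a b
standardPair-shift⁻ E a b (inRow , inCol) = (λ r c → inRow r (ℕ.s<s c)) , (λ c r → inCol (cong suc c) r)
standardPair-shift⁻ S a b (inRow , inCol) = (λ r c → inRow (cong suc r) c) , (λ c r → inCol c (ℕ.s<s r))
standardPair-shift⁻ SE a b (inRow , inCol) = (λ r c → inRow (cong suc r) (ℕ.s<s c)) , (λ c r → inCol (cong suc c) (ℕ.s<s r))

-- The invariant that makes standardness propagate along the ribbon: the first
-- entry is the smallest of the top row and the largest of the leftmost column.
StandardCorner : ℕ → List (Cell × ℕ) → Set
StandardCorner x F = Standard F
  × (∀ b → b ∈ F → row b ≡ 0 → x ≤ val b)
  × (∀ b → b ∈ F → col b ≡ 0 → val b ≤ x)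

standardPair-refl : ∀ a → StandardPair a a
standardPair-refl a = (λ _ lt → ⊥-elim (ℕP.<-irrefl refl lt)) , (λ _ lt → ⊥-elim (ℕP.<-irrefl refl lt))

standardCorner-[_] : ∀ x → StandardCorner x [ ((0 , 0) , x) ]
standardCorner-[ x ] =
  (λ { a b (here refl) (here refl) → standardPair-refl a })
  , (λ { b (here refl) _ → ℕP.≤-refl })
  , (λ { b (here refl) _ → ℕP.≤-refl })

∈-∷-shift⁻ : ∀ {s e F a} → a ∈ e ∷ map (shift s) F → a ≡ e ⊎ ∃ λ a′ → a′ ∈ F × a ≡ shift s a′
∈-∷-shift⁻ (here eq) = inj₁ eq
∈-∷-shift⁻ (there a∈) = inj₂ (∈-map⁻ _ a∈)

standardCorner-∷ : ∀ s x y F → Adjacent s x y → StandardCorner y F →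
  StandardCorner x (((0 , 0) , x) ∷ map (shift s) F)
standardCorner-∷ s x y F adj (std , rowMin , colMax) = standard , rowMin′ , colMax′
  where
  corner = ((0 , 0) , x)
  rowMin-shift : ∀ s → Adjacent s x y → ∀ b → b ∈ F → row (shift s b) ≡ 0 → x < val b
  rowMin-shift E x<y b b∈ r = ℕP.<-≤-trans x<y (rowMin b b∈ r)
  rowMin-shift S _ b b∈ ()
  rowMin-shift SE _ b b∈ ()
  colMax-shift : ∀ s → Adjacent s x y → ∀ b → b ∈ F → col (shift s b) ≡ 0 → val b < x
  colMax-shift E _ b b∈ ()
  colMax-shift S y<x b b∈ c = ℕP.≤-<-trans (colMax b b∈ c) y<x
  colMax-shift SE _ b b∈ ()
  standard : Standard (corner ∷ map (shift s) F)
  standard a b a∈ b∈ with ∈-∷-shift⁻ {F = F} a∈ | ∈-∷-shift⁻ {F = F} b∈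
  ... | inj₁ refl | inj₁ refl = standardPair-refl corner
  ... | inj₁ refl | inj₂ (b′ , b′∈ , refl) = (λ r _ → rowMin-shift s adj b′ b′∈ (sym r)) , (λ _ ())
  ... | inj₂ (a′ , a′∈ , refl) | inj₁ refl = (λ _ ()) , (λ c _ → colMax-shift s adj a′ a′∈ c)
  ... | inj₂ (a′ , a′∈ , refl) | inj₂ (b′ , b′∈ , refl) = standardPair-shift⁺ s a′ b′ (std a′ b′ a′∈ b′∈)
  rowMin′ : ∀ b → b ∈ corner ∷ map (shift s) F → row b ≡ 0 → x ≤ val b
  rowMin′ b b∈ with ∈-∷-shift⁻ {F = F} b∈
  ... | inj₁ refl = λ _ → ℕP.≤-refl
  ... | inj₂ (b′ , b′∈ , refl) = ℕP.<⇒≤ ∘ rowMin-shift s adj b′ b′∈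
  colMax′ : ∀ b → b ∈ corner ∷ map (shift s) F → col b ≡ 0 → val b ≤ x
  colMax′ b b∈ with ∈-∷-shift⁻ {F = F} b∈
  ... | inj₁ refl = λ _ → ℕP.≤-refl
  ... | inj₂ (b′ , b′∈ , refl) = ℕP.<⇒≤ ∘ colMax-shift s adj b′ b′∈

local⇒standardCorner : ∀ w x xs → Local w (x ∷ xs) → StandardCorner x (filling w (x ∷ xs))
local⇒standardCorner [] x xs _ = standardCorner-[ x ]
local⇒standardCorner (s ∷ []) x [] _ = standardCorner-[ x ]
local⇒standardCorner (s ∷ s′ ∷ w) x [] _ = standardCorner-[ x ]
local⇒standardCorner (s ∷ w) x (y ∷ xs) (adj , loc) =
  subst (StandardCorner x) (sym (filling-∷ s w x (y ∷ xs)))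
        (standardCorner-∷ s x y _ adj (local⇒standardCorner w y xs loc))

local⇒SECond : ∀ w xs → Local w xs → SECond w xs
local⇒SECond [] xs _ = tt
local⇒SECond (E ∷ w) [] _ = tt
local⇒SECond (S ∷ w) [] _ = tt
local⇒SECond (SE ∷ w) [] _ = tt
local⇒SECond (E ∷ w) (x ∷ []) _ = tt
local⇒SECond (S ∷ w) (x ∷ []) _ = tt
local⇒SECond (SE ∷ w) (x ∷ []) _ = tt
local⇒SECond (E ∷ w) (x ∷ y ∷ xs) (_ , loc) = local⇒SECond w (y ∷ xs) loc
local⇒SECond (S ∷ w) (x ∷ y ∷ xs) (_ , loc) = local⇒SECond w (y ∷ xs) loc
local⇒SECond (SE ∷ w) (x ∷ y ∷ xs) (x<y , loc) = x<y , local⇒SECond w (y ∷ xs) loc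

local⇒fits : ∀ φ w → suc (length w) ≡ length φ → Local w φ → Fits φ w
local⇒fits (x ∷ xs) w len loc = len , proj₁ (local⇒standardCorner w x xs loc) , local⇒SECond w (x ∷ xs) loc

fits⇒local : ∀ φ w → Fits φ w → Local w φ
fits⇒local (x ∷ xs) w (_ , std , sec) = standard⇒local w x xs std sec
  where
  head∈filling : ∀ w y ys → ((0 , 0) , y) ∈ filling w (y ∷ ys)
  head∈filling [] y ys = here refl
  head∈filling (s ∷ w) y ys = here refl
  standard⇒local : ∀ w x xs → Standard (filling w (x ∷ xs)) → SECond w (x ∷ xs) → Local w (x ∷ xs)
  standard⇒local [] x xs _ _ = tt
  standard⇒local (s ∷ w) x [] _ _ = tt
  standard⇒local (s ∷ w) x (y ∷ xs) std sec =
    adjacent s std′ sec , standard⇒local w y xs std-tail (SECond-tail s sec)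
    where
    F = filling w (y ∷ xs)
    std′ : Standard (((0 , 0) , x) ∷ map (shift s) F)
    std′ = subst Standard (filling-∷ s w x (y ∷ xs)) std
    std-tail : Standard F
    std-tail a b a∈ b∈ = standardPair-shift⁻ s a b
      (std′ (shift s a) (shift s b) (there (∈-map⁺ (shift s) a∈)) (there (∈-map⁺ (shift s) b∈)))
    y∈ : ∀ s → shift s ((0 , 0) , y) ∈ ((0 , 0) , x) ∷ map (shift s) F
    y∈ s = there (∈-map⁺ (shift s) (head∈filling w y xs))
    adjacent : ∀ s → Standard (((0 , 0) , x) ∷ map (shift s) F) → SECond (s ∷ w) (x ∷ y ∷ xs) → Adjacent s x y
    adjacent E std _ = proj₁ (std _ _ (here refl) (y∈ E)) refl (s≤s z≤n)
    adjacent S std _ = proj₂ (std _ _ (y∈ S) (here refl)) refl (s≤s z≤n)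
    adjacent SE _ (x<y , _) = x<y
    SECond-tail : ∀ s → SECond (s ∷ w) (x ∷ y ∷ xs) → SECond w (y ∷ xs)
    SECond-tail E sec = sec
    SECond-tail S sec = sec
    SECond-tail SE (_ , sec) = sec

length-∷ʳ : ∀ {A : Set} (xs : List A) x → length (xs ++ [ x ]) ≡ suc (length xs)
length-∷ʳ xs x = trans (length-++ xs) (ℕP.+-comm (length xs) 1)

rowFactorOf-∷ʳ : ∀ n t p x → All (Neutral n) p → Neutral n x → rowFactorOf n t (p ++ [ x ]) ≡ rowWeight t (suc (length p))
rowFactorOf-∷ʳ n t p x p-neutral x-neutral =
  trans (rowFactorOf-neutral n t (p ++ [ x ]) (++⁺ p-neutral (x-neutral ∷ [])))
        (cong (rowWeight t) (length-∷ʳ p x))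

rowFactors-neutral : ∀ n t w p xs → All (Neutral n) p → All (Neutral n) xs → length xs ≡ suc (length w) →
  rowFactorOf n t (p ++ firstRow w xs) * prodℤ (map (rowFactorOf n t) (laterRows w xs)) ≡ rowProd t (length p) w
rowFactors-neutral n t [] p (x ∷ []) p-neu (x-neu ∷ []) _ =
  trans (ℤP.*-identityʳ _) (rowFactorOf-∷ʳ n t p x p-neu x-neu)
rowFactors-neutral n t (E ∷ w) p (x ∷ xs) p-neu (x-neu ∷ xs-neu) len = begin
  rowFactorOf n t (p ++ x ∷ firstRow w xs) * prodℤ (map (rowFactorOf n t) (laterRows w xs))
    ≡⟨ cong (λ r → rowFactorOf n t r * prodℤ (map (rowFactorOf n t) (laterRows w xs))) (sym (++-assoc p [ x ] (firstRow w xs))) ⟩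
  rowFactorOf n t ((p ++ [ x ]) ++ firstRow w xs) * prodℤ (map (rowFactorOf n t) (laterRows w xs))
    ≡⟨ rowFactors-neutral n t w (p ++ [ x ]) xs (++⁺ p-neu (x-neu ∷ [])) xs-neu (ℕP.suc-injective len) ⟩
  rowProd t (length (p ++ [ x ])) w
    ≡⟨ cong (λ a → rowProd t a w) (length-∷ʳ p x) ⟩
  rowProd t (suc (length p)) w ∎
  where open ≡-Reasoning
rowFactors-neutral n t (S ∷ w) p (x ∷ xs) p-neu (x-neu ∷ xs-neu) len =
  cong₂ _*_ (rowFactorOf-∷ʳ n t p x p-neu x-neu) (rowFactors-neutral n t w [] xs [] xs-neu (ℕP.suc-injective len))
rowFactors-neutral n t (SE ∷ w) p (x ∷ xs) p-neu (x-neu ∷ xs-neu) len =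
  cong₂ _*_ (rowFactorOf-∷ʳ n t p x p-neu x-neu) (rowFactors-neutral n t w [] xs [] xs-neu (ℕP.suc-injective len))

laterRowFactors-neutral : ∀ n t w x xs → All (Neutral n) xs → length xs ≡ length w →
  prodℤ (map (rowFactorOf n t) (laterRows w (x ∷ xs))) ≡ rowProdTail t w
laterRowFactors-neutral n t [] x [] _ _ = refl
laterRowFactors-neutral n t (E ∷ w) x (y ∷ ys) (_ ∷ ys-neu) len = laterRowFactors-neutral n t w y ys ys-neu (ℕP.suc-injective len)
laterRowFactors-neutral n t (S ∷ w) x xs xs-neu len = rowFactors-neutral n t w [] xs [] xs-neu len
laterRowFactors-neutral n t (SE ∷ w) x xs xs-neu len = rowFactors-neutral n t w [] xs [] xs-neu len

rowFactors-lastRow∋n : ∀ n t w p ys → All (Neutral n) p → All (Neutral n) ys → length ys ≡ length w →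
  rowFactorOf n t (p ++ firstRow w (ys ++ [ n ])) * prodℤ (map (rowFactorOf n t) (laterRows w (ys ++ [ n ])))
    ≡ rowProdInit t (length p) w
rowFactors-lastRow∋n n t [] p [] _ _ _ =
  trans (ℤP.*-identityʳ _) (rowFactorOf-∋n n t (p ++ [ n ]) (∈-++⁺ʳ p (here refl)))
rowFactors-lastRow∋n n t (E ∷ w) p (y ∷ ys) p-neu (y-neu ∷ ys-neu) len = begin
  rowFactorOf n t (p ++ y ∷ firstRow w zs) * prodℤ (map (rowFactorOf n t) (laterRows w zs))
    ≡⟨ cong (λ r → rowFactorOf n t r * prodℤ (map (rowFactorOf n t) (laterRows w zs))) (sym (++-assoc p [ y ] (firstRow w zs))) ⟩
  rowFactorOf n t ((p ++ [ y ]) ++ firstRow w zs) * prodℤ (map (rowFactorOf n t) (laterRows w zs))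
    ≡⟨ rowFactors-lastRow∋n n t w (p ++ [ y ]) ys (++⁺ p-neu (y-neu ∷ [])) ys-neu (ℕP.suc-injective len) ⟩
  rowProdInit t (length (p ++ [ y ])) w
    ≡⟨ cong (λ a → rowProdInit t a w) (length-∷ʳ p y) ⟩
  rowProdInit t (suc (length p)) w ∎
  where
  open ≡-Reasoning
  zs = ys ++ [ n ]
rowFactors-lastRow∋n n t (S ∷ w) p (y ∷ ys) p-neu (y-neu ∷ ys-neu) len =
  cong₂ _*_ (rowFactorOf-∷ʳ n t p y p-neu y-neu) (rowFactors-lastRow∋n n t w [] ys [] ys-neu (ℕP.suc-injective len))
rowFactors-lastRow∋n n t (SE ∷ w) p (y ∷ ys) p-neu (y-neu ∷ ys-neu) len =
  cong₂ _*_ (rowFactorOf-∷ʳ n t p y p-neu y-neu) (rowFactors-lastRow∋n n t w [] ys [] ys-neu (ℕP.suc-injective len))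

head∈firstRow : ∀ w x xs → x ∈ firstRow w (x ∷ xs)
head∈firstRow [] x xs = here refl
head∈firstRow (E ∷ w) x xs = here refl
head∈firstRow (S ∷ w) x xs = here refl
head∈firstRow (SE ∷ w) x xs = here refl

firstRow-⊆ : ∀ w xs → firstRow w xs ⊆ xs
firstRow-⊆ [] xs v∈ = v∈
firstRow-⊆ (E ∷ w) (x ∷ xs) (here eq) = here eq
firstRow-⊆ (E ∷ w) (x ∷ xs) (there v∈) = there (firstRow-⊆ w xs v∈)
firstRow-⊆ (S ∷ w) (x ∷ xs) (here eq) = here eq
firstRow-⊆ (SE ∷ w) (x ∷ xs) (here eq) = here eq

⊆-∷ : ∀ {x : ℕ} {r xs} → r ⊆ xs → r ⊆ x ∷ xs
⊆-∷ {x} {xs = xs} r⊆xs = ⊆-trans r⊆xs (xs⊆x∷xs xs x)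

laterRows-⊆ : ∀ w xs → All (_⊆ xs) (laterRows w xs)
laterRows-⊆ [] xs = []
laterRows-⊆ (s ∷ w) [] = []
laterRows-⊆ (E ∷ w) (x ∷ xs) = All.map ⊆-∷ (laterRows-⊆ w xs)
laterRows-⊆ (S ∷ w) (x ∷ xs) = All.map ⊆-∷ (firstRow-⊆ w xs ∷ laterRows-⊆ w xs)
laterRows-⊆ (SE ∷ w) (x ∷ xs) = All.map ⊆-∷ (firstRow-⊆ w xs ∷ laterRows-⊆ w xs)

rows-⊆ : ∀ w xs → All (_⊆ xs) (rows w xs)
rows-⊆ w xs = firstRow-⊆ w xs ∷ laterRows-⊆ w xs

firstRow-∷ʳ-S : ∀ w xs z → length xs ≡ suc (length w) → firstRow (w ++ [ S ]) (xs ++ [ z ]) ≡ firstRow w xs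
firstRow-∷ʳ-S [] (x ∷ []) z _ = refl
firstRow-∷ʳ-S (E ∷ w) (x ∷ xs) z len = cong (x ∷_) (firstRow-∷ʳ-S w xs z (ℕP.suc-injective len))
firstRow-∷ʳ-S (S ∷ w) (x ∷ xs) z _ = refl
firstRow-∷ʳ-S (SE ∷ w) (x ∷ xs) z _ = refl

laterRows-∷ʳ-S : ∀ w xs z → length xs ≡ suc (length w) → laterRows (w ++ [ S ]) (xs ++ [ z ]) ≡ laterRows w xs ++ [ [ z ] ]
laterRows-∷ʳ-S [] (x ∷ []) z _ = refl
laterRows-∷ʳ-S (E ∷ w) (x ∷ xs) z len = laterRows-∷ʳ-S w xs z (ℕP.suc-injective len)
laterRows-∷ʳ-S (S ∷ w) (x ∷ xs) z len =
  cong₂ _∷_ (firstRow-∷ʳ-S w xs z (ℕP.suc-injective len)) (laterRows-∷ʳ-S w xs z (ℕP.suc-injective len))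
laterRows-∷ʳ-S (SE ∷ w) (x ∷ xs) z len =
  cong₂ _∷_ (firstRow-∷ʳ-S w xs z (ℕP.suc-injective len)) (laterRows-∷ʳ-S w xs z (ℕP.suc-injective len))

rows-∷ʳ-S : ∀ w xs z → length xs ≡ suc (length w) → rows (w ++ [ S ]) (xs ++ [ z ]) ≡ rows w xs ++ [ [ z ] ]
rows-∷ʳ-S w xs z len = cong₂ _∷_ (firstRow-∷ʳ-S w xs z len) (laterRows-∷ʳ-S w xs z len)

prodℤ-∷ʳ : ∀ xs x → prodℤ (xs ++ [ x ]) ≡ prodℤ xs * x
prodℤ-∷ʳ [] x = trans (ℤP.*-identityʳ x) (sym (ℤP.*-identityˡ x))
prodℤ-∷ʳ (y ∷ xs) x = trans (cong (y *_) (prodℤ-∷ʳ xs x)) (sym (ℤP.*-assoc y _ x))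

rowFactors-∷ʳ-[1] : ∀ n t w xs → length xs ≡ suc (length w) →
  prodℤ (map (rowFactorOf n t) (rows (w ++ [ S ]) (xs ++ [ 1 ]))) ≡ prodℤ (map (rowFactorOf n t) (rows w xs))
rowFactors-∷ʳ-[1] n t w xs len = begin
  prodℤ (map f (rows (w ++ [ S ]) (xs ++ [ 1 ])))
    ≡⟨ cong (prodℤ ∘ map f) (rows-∷ʳ-S w xs 1 len) ⟩
  prodℤ (map f (rows w xs ++ [ [ 1 ] ]))
    ≡⟨ cong prodℤ (map-++ f (rows w xs) [ [ 1 ] ]) ⟩
  prodℤ (map f (rows w xs) ++ [ f [ 1 ] ])
    ≡⟨ prodℤ-∷ʳ (map f (rows w xs)) (f [ 1 ]) ⟩
  prodℤ (map f (rows w xs)) * f [ 1 ]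
    ≡⟨ cong (prodℤ (map f (rows w xs)) *_) (rowFactorOf-∋1 n t [ 1 ] (here refl)) ⟩
  prodℤ (map f (rows w xs)) * + 1
    ≡⟨ ℤP.*-identityʳ _ ⟩
  prodℤ (map f (rows w xs)) ∎
  where
  open ≡-Reasoning
  f = rowFactorOf n t

Separated : ℕ → List ℕ → Set
Separated n r = ¬ (1 ∈ r × n ∈ r)

separated⇒rowCondition : ∀ n w φ → length φ ≡ suc (length w) → All (Separated n) (rows w φ) →
  ∀ i → i < numRows w → ¬ (1 ∈ rowVals w φ i × n ∈ rowVals w φ i)
separated⇒rowCondition n w φ len separated i _ rewrite rowVals≡rowAt w φ len i = rowAt-All (rows w φ) i separated
  where
  rowAt-All : ∀ rs i → All (Separated n) rs → Separated n (rowAt rs i)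
  rowAt-All [] i _ (() , _)
  rowAt-All (r ∷ rs) zero (sep ∷ _) = sep
  rowAt-All (r ∷ rs) (suc i) (_ ∷ seps) = rowAt-All rs i seps

ΦSum≡signedSum : ∀ n φ t k (shape : List Step → List Step) (P : List Step → ℤ) →
  (∀ {w w′} → shape w ≡ shape w′ → w ≡ w′) →
  (∀ w → length w ≡ k → NoSouth w → InΦ n φ (shape w)) →
  (∀ Γ → InΦ n φ Γ → ∃ λ w → length w ≡ k × NoSouth w × Γ ≡ shape w) →
  (∀ w → length w ≡ k → NoSouth w → weight n φ t (shape w) ≡ sign (eastSteps w) * P w) →
  ∀ L → EnumΦ n φ L → ΦSum n φ t L ≡ signedSum P k
ΦSum≡signedSum n φ t k shape P shape-injective inΦ classify weight-shape L (L-unique , L⇔Φ) = begin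
  sumℤ (map (weight n φ t) L)
    ≡⟨ sumℤ-enumerations (weight n φ t) L-unique (Unique.map⁺ shape-injective (noSouthWords-unique k)) L⇔Φ M⇔Φ ⟩
  sumℤ (map (weight n φ t) (map shape W))
    ≡⟨ cong sumℤ (sym (map-∘ W)) ⟩
  sumℤ (map (weight n φ t ∘ shape) W)
    ≡⟨ cong sumℤ (map-cong-local (All.tabulate λ w∈ → uncurry (weight-shape _) (∈-noSouthWords⁻ k w∈))) ⟩
  signedSum P k ∎
  where
  open ≡-Reasoning
  W = noSouthWords k
  M⇔Φ : ∀ Γ → (Γ ∈ map shape W) ⇔ InΦ n φ Γ
  M⇔Φ Γ = mk⇔ to from
    where
    to : Γ ∈ map shape W → InΦ n φ Γ
    to Γ∈ with ∈-map⁻ shape Γ∈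
    ... | w , w∈ , refl = uncurry (inΦ w) (∈-noSouthWords⁻ k w∈)
    from : InΦ n φ Γ → Γ ∈ map shape W
    from Γ∈Φ with classify Γ Γ∈Φ
    ... | w , len , ns , refl = ∈-map⁺ shape (∈-noSouthWords⁺ w len ns)

fromTwo : ℕ → List ℕ
fromTwo m = applyUpTo (λ i → 2 ℕ.+ i) m

length-fromTwo : ∀ m → length (fromTwo m) ≡ m
length-fromTwo = length-applyUpTo (λ i → 2 ℕ.+ i)

fromTwo-∷ʳ : ∀ m → fromTwo (suc m) ≡ fromTwo m ++ [ 2 ℕ.+ m ]
fromTwo-∷ʳ m = sym (applyUpTo-∷ʳ (λ i → 2 ℕ.+ i) m)

fromTwo-increasing : ∀ m → Linked _<_ (fromTwo m)
fromTwo-increasing m = applyUpTo-increasing (λ i → 2 ℕ.+ i) m (λ i → ℕP.n<1+n (2 ℕ.+ i))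
  where
  applyUpTo-increasing : ∀ f m → (∀ i → f i < f (suc i)) → Linked _<_ (applyUpTo f m)
  applyUpTo-increasing f zero _ = Linked.[]
  applyUpTo-increasing f (suc zero) _ = Linked.[-]
  applyUpTo-increasing f (suc (suc m)) inc = inc 0 Linked.∷ applyUpTo-increasing (f ∘ suc) (suc m) (inc ∘ suc)

fromTwo-above1 : ∀ m → All (1 <_) (fromTwo m)
fromTwo-above1 m = applyUpTo⁺₁ (λ i → 2 ℕ.+ i) m (λ _ → s≤s (s≤s z≤n))

fromTwo-neutral : ∀ n m → 2 ℕ.+ m ≤ n → All (Neutral n) (fromTwo m)
fromTwo-neutral n m 2+m≤n = applyUpTo⁺₁ (λ i → 2 ℕ.+ i) m
  (λ i<m → (λ ()) , ℕP.>⇒≢ (ℕP.<-≤-trans (ℕP.+-monoʳ-< 2 i<m) 2+m≤n))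

local⇒noSouth : ∀ w xs → Linked _<_ xs → Local w xs → length xs ≡ suc (length w) → NoSouth w
local⇒noSouth [] xs _ _ _ = tt
local⇒noSouth (E ∷ w) (x ∷ y ∷ xs) (_ Linked.∷ inc) (_ , loc) len = local⇒noSouth w (y ∷ xs) inc loc (ℕP.suc-injective len)
local⇒noSouth (S ∷ w) (x ∷ y ∷ xs) (x<y Linked.∷ _) (y<x , _) _ = ℕP.<-asym x<y y<x
local⇒noSouth (SE ∷ w) (x ∷ y ∷ xs) (_ Linked.∷ inc) (_ , loc) len = local⇒noSouth w (y ∷ xs) inc loc (ℕP.suc-injective len)

noSouth⇒local : ∀ w xs → Linked _<_ xs → NoSouth w → Local w xs
noSouth⇒local [] xs _ _ = tt
noSouth⇒local (s ∷ w) [] _ _ = tt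
noSouth⇒local (s ∷ w) (x ∷ []) _ _ = tt
noSouth⇒local (E ∷ w) (x ∷ y ∷ xs) (x<y Linked.∷ inc) ns = x<y , noSouth⇒local w (y ∷ xs) inc ns
noSouth⇒local (SE ∷ w) (x ∷ y ∷ xs) (x<y Linked.∷ inc) ns = x<y , noSouth⇒local w (y ∷ xs) inc ns

local-∷ʳ⇒ : ∀ Γ x xs y → Linked _<_ (x ∷ xs) → All (y <_) (x ∷ xs) →
  Local Γ ((x ∷ xs) ++ [ y ]) → length Γ ≡ length (x ∷ xs) →
  ∃ λ w → length (x ∷ xs) ≡ suc (length w) × NoSouth w × Γ ≡ w ++ [ S ]
local-∷ʳ⇒ (E ∷ []) x [] y _ (y<x ∷ _) (x<y , _) _ = ⊥-elim (ℕP.<-asym x<y y<x)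
local-∷ʳ⇒ (S ∷ []) x [] y _ _ _ _ = [] , refl , tt , refl
local-∷ʳ⇒ (SE ∷ []) x [] y _ (y<x ∷ _) (x<y , _) _ = ⊥-elim (ℕP.<-asym x<y y<x)
local-∷ʳ⇒ (S ∷ s ∷ Γ) x (x′ ∷ xs) y (x<x′ Linked.∷ _) _ (x′<x , _) _ = ⊥-elim (ℕP.<-asym x<x′ x′<x)
local-∷ʳ⇒ (E ∷ s ∷ Γ) x (x′ ∷ xs) y (_ Linked.∷ inc) (_ ∷ above) (_ , loc) len
  with local-∷ʳ⇒ (s ∷ Γ) x′ xs y inc above loc (ℕP.suc-injective len)
... | w , len′ , ns , eq = E ∷ w , cong suc len′ , ns , cong (E ∷_) eq
local-∷ʳ⇒ (SE ∷ s ∷ Γ) x (x′ ∷ xs) y (_ Linked.∷ inc) (_ ∷ above) (_ , loc) len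
  with local-∷ʳ⇒ (s ∷ Γ) x′ xs y inc above loc (ℕP.suc-injective len)
... | w , len′ , ns , eq = SE ∷ w , cong suc len′ , ns , cong (SE ∷_) eq

local-∷ʳ⇐ : ∀ w x xs y → Linked _<_ (x ∷ xs) → All (y <_) (x ∷ xs) → NoSouth w → length (x ∷ xs) ≡ suc (length w) →
  Local (w ++ [ S ]) ((x ∷ xs) ++ [ y ])
local-∷ʳ⇐ [] x [] y _ (y<x ∷ _) _ _ = y<x , tt
local-∷ʳ⇐ (E ∷ w) x (x′ ∷ xs) y (x<x′ Linked.∷ inc) (_ ∷ above) ns len =
  x<x′ , local-∷ʳ⇐ w x′ xs y inc above ns (ℕP.suc-injective len)
local-∷ʳ⇐ (SE ∷ w) x (x′ ∷ xs) y (x<x′ Linked.∷ inc) (_ ∷ above) ns len =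
  x<x′ , local-∷ʳ⇐ w x′ xs y inc above ns (ℕP.suc-injective len)

-- φ = (n, 1, 2, …, n-1): the shapes S ∷ w, with 1 in the first row of w

module WordA (k : ℕ) where
  n : ℕ
  n = 3 ℕ.+ k
  ys : List ℕ
  ys = fromTwo (suc k)
  φ : List ℕ
  φ = n ∷ 1 ∷ ys

  ys-neutral : All (Neutral n) ys
  ys-neutral = fromTwo-neutral n (suc k) ℕP.≤-refl

  1∷ys-increasing : Linked _<_ (1 ∷ ys)
  1∷ys-increasing = s≤s (s≤s z≤n) Linked.∷ fromTwo-increasing (suc k)

  length-ys : length ys ≡ suc k
  length-ys = length-fromTwo (suc k)

  inΦ : ∀ w → length w ≡ suc k → NoSouth w → InΦ n φ (S ∷ w)
  inΦ w len ns = local⇒fits φ (S ∷ w) len′ (s≤s (s≤s z≤n) , noSouth⇒local w (1 ∷ ys) 1∷ys-increasing ns)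
               , separated⇒rowCondition n (S ∷ w) φ (sym len′) ((λ { (here () , _) }) ∷ All.map apart (rows-⊆ w (1 ∷ ys)))
    where
    len′ : suc (length (S ∷ w)) ≡ length φ
    len′ = cong (suc ∘ suc) (trans len (sym length-ys))
    n∉1∷ys : ¬ n ∈ 1 ∷ ys
    n∉1∷ys (here ())
    n∉1∷ys (there n∈ys) = All¬⇒¬Any (All.map proj₂ ys-neutral) n∈ys
    apart : ∀ {r} → r ⊆ 1 ∷ ys → Separated n r
    apart r⊆ (_ , n∈r) = n∉1∷ys (r⊆ n∈r)

  classify : ∀ Γ → InΦ n φ Γ → ∃ λ w → length w ≡ suc k × NoSouth w × Γ ≡ S ∷ w
  classify Γ (fits , _) = byFirstStep Γ (fits⇒local φ Γ fits) (proj₁ fits)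
    where
    byFirstStep : ∀ Γ → Local Γ φ → suc (length Γ) ≡ length φ →
      ∃ λ w → length w ≡ suc k × NoSouth w × Γ ≡ S ∷ w
    byFirstStep (E ∷ w) (s≤s () , _) _
    byFirstStep (SE ∷ w) (s≤s () , _) _
    byFirstStep (S ∷ w) (_ , loc) len =
      w , len′ , local⇒noSouth w (1 ∷ ys) 1∷ys-increasing loc (cong suc (trans length-ys (sym len′))) , refl
      where
      len′ : length w ≡ suc k
      len′ = trans (ℕP.suc-injective (ℕP.suc-injective len)) length-ys

  weight-S∷ : ∀ t w → length w ≡ suc k → NoSouth w → weight n φ t (S ∷ w) ≡ sign (eastSteps w) * rowProdTail t w
  weight-S∷ t w len _ = trans (weight≡rowFactors n t (S ∷ w) φ n≡ φ≡)
    (cong (sign (eastSteps w) *_) (begin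
      f [ n ] * (f (firstRow w (1 ∷ ys)) * prodℤ (map f (laterRows w (1 ∷ ys))))
        ≡⟨ cong₂ (λ a b → a * (b * prodℤ (map f (laterRows w (1 ∷ ys)))))
                 (rowFactorOf-∋n n t [ n ] (here refl)) (rowFactorOf-∋1 n t _ (head∈firstRow w 1 ys)) ⟩
      + 1 * (+ 1 * prodℤ (map f (laterRows w (1 ∷ ys))))
        ≡⟨ trans (ℤP.*-identityˡ _) (ℤP.*-identityˡ _) ⟩
      prodℤ (map f (laterRows w (1 ∷ ys)))
        ≡⟨ laterRowFactors-neutral n t w 1 ys ys-neutral (trans length-ys (sym len)) ⟩
      rowProdTail t w ∎))
    where
    open ≡-Reasoning
    f = rowFactorOf n t
    n≡ : n ≡ suc (length (S ∷ w))
    n≡ = cong (λ m → suc (suc m)) (sym len)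
    φ≡ : length φ ≡ suc (length (S ∷ w))
    φ≡ = cong (λ m → suc (suc m)) (trans length-ys (sym len))

  ΦSum-φ : ∀ t L → EnumΦ n φ L → ΦSum n φ t L ≡ (t - + 1) ^ k * t
  ΦSum-φ t L enum = trans (ΦSum≡signedSum n φ t (suc k) (S ∷_) (rowProdTail t) ∷-injectiveʳ inΦ classify (weight-S∷ t) L enum)
                          (signedSum-rowProdTail t k)

separated-∷ʳ-[1] : ∀ n w zs → ¬ n ≡ 1 → All (1 <_) zs → length zs ≡ suc (length w) →
  All (Separated n) (rows (w ++ [ S ]) (zs ++ [ 1 ]))
separated-∷ʳ-[1] n w zs n≢1 above len = subst (All (Separated n)) (sym (rows-∷ʳ-S w zs 1 len))
  (++⁺ (All.map apart (rows-⊆ w zs)) ((λ { (_ , here n≡1) → n≢1 n≡1 }) ∷ []))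
  where
  1∉zs : ¬ 1 ∈ zs
  1∉zs = All¬⇒¬Any (All.map (λ 1<v → ℕP.<⇒≢ 1<v) above)
  apart : ∀ {r} → r ⊆ zs → Separated n r
  apart r⊆ (1∈r , _) = 1∉zs (r⊆ 1∈r)

-- φ = (2, …, n, 1): the shapes w ++ [S], with n in the last row of w

module WordB (k : ℕ) where
  n : ℕ
  n = 3 ℕ.+ k
  zs : List ℕ
  zs = fromTwo (2 ℕ.+ k)
  φ : List ℕ
  φ = zs ++ [ 1 ]

  length-zs : ∀ (w : List Step) → length w ≡ suc k → length zs ≡ suc (length w)
  length-zs w len = trans (length-fromTwo (2 ℕ.+ k)) (cong suc (sym len))

  length-φ : ∀ (w : List Step) → length w ≡ suc k → suc (length (w ++ [ S ])) ≡ length φ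
  length-φ w len = begin
    suc (length (w ++ [ S ])) ≡⟨ cong suc (length-∷ʳ w S) ⟩
    suc (suc (length w))      ≡⟨ cong suc (sym (length-zs w len)) ⟩
    suc (length zs)           ≡⟨ sym (length-∷ʳ zs 1) ⟩
    length φ ∎
    where open ≡-Reasoning

  inΦ : ∀ w → length w ≡ suc k → NoSouth w → InΦ n φ (w ++ [ S ])
  inΦ w len ns = local⇒fits φ (w ++ [ S ]) (length-φ w len) loc
               , separated⇒rowCondition n (w ++ [ S ]) φ (sym (length-φ w len))
                   (separated-∷ʳ-[1] n w zs (λ ()) (fromTwo-above1 (2 ℕ.+ k)) (length-zs w len))
    where
    loc : Local (w ++ [ S ]) φ
    loc = local-∷ʳ⇐ w _ _ 1 (fromTwo-increasing (2 ℕ.+ k)) (fromTwo-above1 (2 ℕ.+ k)) ns (length-zs w len)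

  classify : ∀ Γ → InΦ n φ Γ → ∃ λ w → length w ≡ suc k × NoSouth w × Γ ≡ w ++ [ S ]
  classify Γ (fits , _) with local-∷ʳ⇒ Γ _ _ 1 (fromTwo-increasing (2 ℕ.+ k)) (fromTwo-above1 (2 ℕ.+ k))
                                (fits⇒local φ Γ fits) lenΓ
    where
    lenΓ : length Γ ≡ length zs
    lenΓ = ℕP.suc-injective (trans (proj₁ fits) (length-∷ʳ zs 1))
  ... | w , len , ns , eq = w , ℕP.suc-injective (trans (sym len) (length-fromTwo (2 ℕ.+ k))) , ns , eq

  weight-∷ʳS : ∀ t w → length w ≡ suc k → NoSouth w → weight n φ t (w ++ [ S ]) ≡ sign (eastSteps w) * rowProdInit t 0 w
  weight-∷ʳS t w len _ = begin
    weight n φ t (w ++ [ S ])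
      ≡⟨ weight≡rowFactors n t (w ++ [ S ]) φ n≡ (sym (length-φ w len)) ⟩
    sign (eastSteps (w ++ [ S ])) * prodℤ (map f (rows (w ++ [ S ]) φ))
      ≡⟨ cong₂ _*_ (cong sign (eastSteps-∷ʳ-S w)) (rowFactors-∷ʳ-[1] n t w zs (length-zs w len)) ⟩
    sign (eastSteps w) * prodℤ (map f (rows w zs))
      ≡⟨ cong (λ xs → sign (eastSteps w) * prodℤ (map f (rows w xs))) (fromTwo-∷ʳ (suc k)) ⟩
    sign (eastSteps w) * prodℤ (map f (rows w (fromTwo (suc k) ++ [ n ])))
      ≡⟨ cong (sign (eastSteps w) *_) (rowFactors-lastRow∋n n t w [] (fromTwo (suc k)) []
                                        (fromTwo-neutral n (suc k) ℕP.≤-refl) (trans (length-fromTwo (suc k)) (sym len))) ⟩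
    sign (eastSteps w) * rowProdInit t 0 w ∎
    where
    open ≡-Reasoning
    f = rowFactorOf n t
    n≡ : n ≡ suc (length (w ++ [ S ]))
    n≡ = trans (cong (suc ∘ suc) (sym len)) (cong suc (sym (length-∷ʳ w S)))

  ΦSum-φ : ∀ t L → EnumΦ n φ L → ΦSum n φ t L ≡ (t - + 1) ^ k * t
  ΦSum-φ t L enum = begin
    ΦSum n φ t L
      ≡⟨ ΦSum≡signedSum n φ t (suc k) (_++ [ S ]) (rowProdInit t 0) (∷ʳ-injectiveˡ _ _)
                        inΦ classify (weight-∷ʳS t) L enum ⟩
    signedSum (rowProdInit t 0) (suc k)
      ≡⟨ signedSum-rowProdInit t k 0 ⟩
    (t - + 1) ^ k * t * + 1
      ≡⟨ ℤP.*-identityʳ _ ⟩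
    (t - + 1) ^ k * t ∎
    where open ≡-Reasoning

-- φ = (n, 2, …, n-1, 1): the shapes S ∷ w ++ [S]

module WordC (k : ℕ) where
  n : ℕ
  n = 4 ℕ.+ k
  zs : List ℕ
  zs = fromTwo (2 ℕ.+ k)
  φ : List ℕ
  φ = n ∷ (zs ++ [ 1 ])

  shape : List Step → List Step
  shape w = S ∷ (w ++ [ S ])

  shape-injective : ∀ {w w′} → shape w ≡ shape w′ → w ≡ w′
  shape-injective eq = ∷ʳ-injectiveˡ _ _ (∷-injectiveʳ eq)

  zs-neutral : All (Neutral n) zs
  zs-neutral = fromTwo-neutral n (2 ℕ.+ k) ℕP.≤-refl

  length-zs : ∀ (w : List Step) → length w ≡ suc k → length zs ≡ suc (length w)
  length-zs w len = trans (length-fromTwo (2 ℕ.+ k)) (cong suc (sym len))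

  length-φ : ∀ (w : List Step) → length w ≡ suc k → suc (length (shape w)) ≡ length φ
  length-φ w len = begin
    suc (suc (length (w ++ [ S ]))) ≡⟨ cong (suc ∘ suc) (length-∷ʳ w S) ⟩
    suc (suc (suc (length w)))      ≡⟨ cong (suc ∘ suc) (sym (length-zs w len)) ⟩
    suc (suc (length zs))           ≡⟨ cong suc (sym (length-∷ʳ zs 1)) ⟩
    length φ ∎
    where open ≡-Reasoning

  inΦ : ∀ w → length w ≡ suc k → NoSouth w → InΦ n φ (shape w)
  inΦ w len ns = local⇒fits φ (shape w) (length-φ w len) (s≤s (s≤s (s≤s z≤n)) , loc)
               , separated⇒rowCondition n (shape w) φ (sym (length-φ w len))
                   ((λ { (here () , _) }) ∷ separated-∷ʳ-[1] n w zs (λ ()) (fromTwo-above1 (2 ℕ.+ k)) (length-zs w len))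
    where
    loc : Local (w ++ [ S ]) (zs ++ [ 1 ])
    loc = local-∷ʳ⇐ w _ _ 1 (fromTwo-increasing (2 ℕ.+ k)) (fromTwo-above1 (2 ℕ.+ k)) ns (length-zs w len)

  classify : ∀ Γ → InΦ n φ Γ → ∃ λ w → length w ≡ suc k × NoSouth w × Γ ≡ shape w
  classify Γ (fits , _) = byFirstStep Γ (fits⇒local φ Γ fits) (proj₁ fits)
    where
    byFirstStep : ∀ Γ → Local Γ φ → suc (length Γ) ≡ length φ →
      ∃ λ w → length w ≡ suc k × NoSouth w × Γ ≡ shape w
    byFirstStep (E ∷ Γ′) (s≤s (s≤s ()) , _) _
    byFirstStep (SE ∷ Γ′) (s≤s (s≤s ()) , _) _
    byFirstStep (S ∷ Γ′) (_ , loc) len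
      with local-∷ʳ⇒ Γ′ _ _ 1 (fromTwo-increasing (2 ℕ.+ k)) (fromTwo-above1 (2 ℕ.+ k)) loc
                     (ℕP.suc-injective (ℕP.suc-injective (trans len (cong suc (length-∷ʳ zs 1)))))
    ... | w , len′ , ns , eq = w , ℕP.suc-injective (trans (sym len′) (length-fromTwo (2 ℕ.+ k))) , ns , cong (S ∷_) eq

  weight-shape : ∀ t w → length w ≡ suc k → NoSouth w → weight n φ t (shape w) ≡ sign (eastSteps w) * rowProd t 0 w
  weight-shape t w len _ = begin
    weight n φ t (shape w)
      ≡⟨ weight≡rowFactors n t (shape w) φ n≡ (sym (length-φ w len)) ⟩
    sign (eastSteps (w ++ [ S ])) * (f [ n ] * prodℤ (map f (rows (w ++ [ S ]) (zs ++ [ 1 ]))))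
      ≡⟨ cong₂ (λ e p → sign e * (p * prodℤ (map f (rows (w ++ [ S ]) (zs ++ [ 1 ])))))
               (eastSteps-∷ʳ-S w) (rowFactorOf-∋n n t [ n ] (here refl)) ⟩
    sign (eastSteps w) * (+ 1 * prodℤ (map f (rows (w ++ [ S ]) (zs ++ [ 1 ]))))
      ≡⟨ cong (sign (eastSteps w) *_) (trans (ℤP.*-identityˡ _) (rowFactors-∷ʳ-[1] n t w zs (length-zs w len))) ⟩
    sign (eastSteps w) * prodℤ (map f (rows w zs))
      ≡⟨ cong (sign (eastSteps w) *_) (rowFactors-neutral n t w [] zs [] zs-neutral (length-zs w len)) ⟩
    sign (eastSteps w) * rowProd t 0 w ∎
    where
    open ≡-Reasoning
    f = rowFactorOf n t
    n≡ : n ≡ suc (length (shape w))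
    n≡ = trans (cong (suc ∘ suc ∘ suc) (sym len)) (cong (suc ∘ suc) (sym (length-∷ʳ w S)))

  ΦSum-φ : ∀ t L → EnumΦ n φ L → ΦSum n φ t L ≡ (t - + 1) ^ k * (t * t)
  ΦSum-φ t L enum = begin
    ΦSum n φ t L
      ≡⟨ ΦSum≡signedSum n φ t (suc k) shape (rowProd t 0) shape-injective inΦ classify (weight-shape t) L enum ⟩
    signedSum (rowProd t 0) (suc k)
      ≡⟨ signedSum-rowProd t k 0 ⟩
    (t - + 1) ^ k * (t * t) * + 1
      ≡⟨ ℤP.*-identityʳ _ ⟩
    (t - + 1) ^ k * (t * t) ∎
    where open ≡-Reasoning

φA≡ : ∀ k → φA (3 ℕ.+ k) ≡ WordA.φ k
φA≡ k = cong (3 ℕ.+ k ∷_) (map-upTo suc (2 ℕ.+ k))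

φB≡ : ∀ k → φB (3 ℕ.+ k) ≡ WordB.φ k
φB≡ k = cong (_++ [ 1 ]) (map-upTo (λ i → 2 ℕ.+ i) (2 ℕ.+ k))

φC≡ : ∀ k → φC (4 ℕ.+ k) ≡ WordC.φ k
φC≡ k = cong (λ xs → 4 ℕ.+ k ∷ (xs ++ [ 1 ])) (map-upTo (λ i → 2 ℕ.+ i) (2 ℕ.+ k))

lemma6p6 : (∀ (n : ℕ) → 3 ≤ n → ∀ (φ : List ℕ) → (φ ≡ φA n ⊎ φ ≡ φB n) →
      ∀ (L : List (List Step)) → EnumΦ n φ L → ∀ (t : ℤ) →
        (t - + 1) ^ (n ∸ 3) * t ≡ ΦSum n φ t L)
    ×
    (∀ (n : ℕ) → 4 ≤ n → ∀ (L : List (List Step)) → EnumΦ n (φC n) L → ∀ (t : ℤ) →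
        (t - + 1) ^ (n ∸ 4) * (t * t) ≡ ΦSum n (φC n) t L)
lemma6p6 = partOne , partTwo
  where
  via : ∀ {n φ ψ t L c} → φ ≡ ψ → (EnumΦ n ψ L → ΦSum n ψ t L ≡ c) → EnumΦ n φ L → c ≡ ΦSum n φ t L
  via refl sum≡ enum = sym (sum≡ enum)
  partOne : ∀ n → 3 ≤ n → ∀ φ → φ ≡ φA n ⊎ φ ≡ φB n →
    ∀ L → EnumΦ n φ L → ∀ t → (t - + 1) ^ (n ∸ 3) * t ≡ ΦSum n φ t L
  partOne (suc (suc (suc k))) (s≤s (s≤s (s≤s _))) φ (inj₁ φ≡φA) L enum t =
    via (trans φ≡φA (φA≡ k)) (WordA.ΦSum-φ k t L) enum
  partOne (suc (suc (suc k))) (s≤s (s≤s (s≤s _))) φ (inj₂ φ≡φB) L enum t =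
    via (trans φ≡φB (φB≡ k)) (WordB.ΦSum-φ k t L) enum
  partTwo : ∀ n → 4 ≤ n → ∀ L → EnumΦ n (φC n) L → ∀ t → (t - + 1) ^ (n ∸ 4) * (t * t) ≡ ΦSum n (φC n) t L
  partTwo (suc (suc (suc (suc k)))) (s≤s (s≤s (s≤s (s≤s _)))) L enum t = via (φC≡ k) (WordC.ΦSum-φ k t L) enum
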